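{- Let ${\bf n}'=n'_1n'_2\cdots$ be the fixed point of $0\mapsto01$, $1\mapsto2$, $2\mapsto0$ starting with $0$, indexed from $1$. Let $i\in\{0,1,2\}$. Then a positive integer $k$ satisfies $n'_k=i$ if and only if there exists $s\ge0$ such that the Narayana representation $(k)_N$ ends in a $1$ followed by exactly $3s+i$ zeros.
   Context: Narayana numbers: $N_0=1,N_1=2,N_2=3$, $N_i=N_{i-1}+N_{i-3}$ for $i\ge3$. The Narayana representation $(k)_N$ of a positive integer $k$ is the unique binary word $e_1\cdots e_t$ with $e_1=1$, no factor $11$ or $101$, and $k=\sum_{i=1}^te_iN_{t-i}$. -}

module Defs where

open import Data.Nat using (ℕ; zero; suc; _+_; _*_; _<_)
open import Data.List using (List; []; _∷_; _++_; length; concatMap; replicate)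
open import Data.Product using (_×_; Σ; ∃; _,_)
open import Data.Sum using (_⊎_)
open import Data.Empty using (⊥)
open import Data.Unit using (⊤)
open import Relation.Binary.PropositionalEquality using (_≡_)
open import Relation.Nullary using (¬_)

N : ℕ → ℕ
N 0 = 1
N 1 = 2
N 2 = 3
N (suc (suc (suc i))) = N (suc (suc i)) + N i

Word : Set
Word = List ℕ

Binary : Word → Set
Binary [] = ⊤
Binary (b ∷ w) = ((b ≡ 0) ⊎ (b ≡ 1)) × Binary w

NoBadFactor : Word → Set
NoBadFactor [] = ⊤
NoBadFactor (a ∷ []) = ⊤
NoBadFactor (1 ∷ 1 ∷ w) = ⊥
NoBadFactor (1 ∷ 0 ∷ 1 ∷ w) = ⊥
NoBadFactor (a ∷ b ∷ w) = NoBadFactor (b ∷ w)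

value : Word → ℕ
value [] = 0
value (e ∷ w) = e * N (length w) + value w

IsNarayanaRep : Word → ℕ → Set
IsNarayanaRep [] k = ⊥
IsNarayanaRep (e ∷ w) k =
  e ≡ 1 × Binary (e ∷ w) × NoBadFactor (e ∷ w) × value (e ∷ w) ≡ k

-- the morphism 0 ↦ 01, 1 ↦ 2, 2 ↦ 0 (letters outside {0,1,2} never occur)
σ : ℕ → List ℕ
σ 0 = 0 ∷ 1 ∷ []
σ 1 = 2 ∷ []
σ _ = 0 ∷ []

σ* : List ℕ → List ℕ
σ* = concatMap σ

iter : ℕ → List ℕ
iter zero = 0 ∷ []
iter (suc m) = σ* (iter m)

-- j-th letter (0-indexed) of a list, default 0 if out of range
at : List ℕ → ℕ → ℕ
at [] _ = 0
at (x ∷ xs) zero = x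
at (x ∷ xs) (suc j) = at xs j

-- n'_k for k ≥ 1 (1-indexed): the k-th letter of the fixed point starting
-- with 0.  σ^k(0) is a prefix of the fixed point of length ≥ k + 1, so its
-- k-th letter (index k-1) is the k-th letter of the fixed point.
n' : ℕ → ℕ
n' k = at (iter k) (k Data.Nat.∸ 1)

-- Since σ^{m+3}(0) = σ^{m+2}(0) σ^m(0) and |σ^m(0)| = N_m, the fixed point satisfies
-- n'_{N_{m+2} + r} = n'_r for 1 ≤ r ≤ N_m, and n'_{N_m} = m mod 3 (the last letter of
-- σ^m(0)).  An admissible word 1 0^a w with w beginning with 1 has a ≥ 2 and value
-- N_{a+|w|} + value w, where value w < N_{|w|}; so stripping the leading block 1 0^a
-- leaves n' unchanged.  Stripping repeatedly, n'_k is determined by the final block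
-- 1 0^z alone and equals z mod 3.  Representations exist by the greedy algorithm.
module Submission where

open import Defs
open import Data.Nat using (ℕ; zero; suc; _+_; _*_; _≤_; _<_; _≤′_; ≤′-reflexive; ≤′-step; z≤n; s≤s)
open import Data.Nat.Properties
open import Data.Nat.DivMod using (_%_; _/_; m≡m%n+[m/n]*n; [m+kn]%n≡m%n; [m+n]%n≡m%n; m<n⇒m%n≡m)
open import Data.Nat.Induction using (<-rec)
open import Data.List using ([]; _∷_; _++_; replicate; length)
open import Data.List.Properties using (length-++; length-replicate; concatMap-++; ++-identityʳ)
open import Data.Product using (_×_; ∃; ∃₂; _,_; proj₂)
open import Data.Sum using (_⊎_; inj₁; inj₂)
open import Data.Unit using (tt)
open import Data.Empty using (⊥-elim)
open import Relation.Nullary using (yes; no)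
open import Function.Bundles using (_⇔_; mk⇔; Equivalence)
open import Relation.Binary.PropositionalEquality
  using (_≡_; refl; sym; trans; cong; cong₂; subst; module ≡-Reasoning)

open Equivalence using (to; from)

N-pos : ∀ n → 0 < N n
N-pos 0 = s≤s z≤n
N-pos 1 = s≤s z≤n
N-pos 2 = s≤s z≤n
N-pos (suc (suc (suc n))) = ≤-trans (N-pos (suc (suc n))) (m≤m+n (N (2 + n)) (N n))

N-<-suc : ∀ n → N n < N (suc n)
N-<-suc 0 = s≤s (s≤s z≤n)
N-<-suc 1 = s≤s (s≤s (s≤s z≤n))
N-<-suc (suc (suc n)) =
  subst (_≤ N (2 + n) + N n) (+-comm (N (2 + n)) 1) (+-monoʳ-≤ (N (2 + n)) (N-pos n))

N-mono-≤′ : ∀ {m n} → m ≤′ n → N m ≤ N n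
N-mono-≤′ (≤′-reflexive refl) = ≤-refl
N-mono-≤′ (≤′-step {n} m≤′n) = ≤-trans (N-mono-≤′ m≤′n) (<⇒≤ (N-<-suc n))

N-mono-≤ : ∀ {m n} → m ≤ n → N m ≤ N n
N-mono-≤ m≤n = N-mono-≤′ (≤⇒≤′ m≤n)

N-cancel-< : ∀ {m n} → N m < N n → m < n
N-cancel-< {m} {n} Nm<Nn with m <? n
... | yes m<n = m<n
... | no m≮n = ⊥-elim (<⇒≱ Nm<Nn (N-mono-≤ (≮⇒≥ m≮n)))

n<N : ∀ n → n < N n
n<N zero = s≤s z≤n
n<N (suc n) = <-≤-trans (s≤s (n<N n)) (N-<-suc n)

at-++ˡ : ∀ xs ys {j} → j < length xs → at (xs ++ ys) j ≡ at xs j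
at-++ˡ (x ∷ xs) ys {zero} _ = refl
at-++ˡ (x ∷ xs) ys {suc j} (s≤s j<) = at-++ˡ xs ys j<

at-++ʳ : ∀ xs ys j → at (xs ++ ys) (length xs + j) ≡ at ys j
at-++ʳ [] ys j = refl
at-++ʳ (x ∷ xs) ys j = at-++ʳ xs ys j

iter-+3 : ∀ m → iter (3 + m) ≡ iter (2 + m) ++ iter m
iter-+3 zero = refl
iter-+3 (suc m) = trans (cong σ* (iter-+3 m)) (concatMap-++ σ (iter (2 + m)) (iter m))

length-iter : ∀ m → length (iter m) ≡ N m
length-iter 0 = refl
length-iter 1 = refl
length-iter 2 = refl
length-iter (suc (suc (suc m))) = begin
  length (iter (3 + m))                ≡⟨ cong length (iter-+3 m) ⟩
  length (iter (2 + m) ++ iter m)      ≡⟨ length-++ (iter (2 + m)) ⟩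
  length (iter (2 + m)) + length (iter m)
    ≡⟨ cong₂ _+_ (length-iter (suc (suc m))) (length-iter m) ⟩
  N (2 + m) + N m                      ∎
  where open ≡-Reasoning

iter-prefix : ∀ m → ∃ λ e → iter (suc m) ≡ iter m ++ e
iter-prefix 0 = _ , refl
iter-prefix 1 = _ , refl
iter-prefix (suc (suc m)) = _ , iter-+3 m

at-iter-suc : ∀ m {j} → j < N m → at (iter (suc m)) j ≡ at (iter m) j
at-iter-suc m {j} j<N with iter-prefix m
... | e , eq = trans (cong (λ w → at w j) eq)
                     (at-++ˡ (iter m) e (subst (j <_) (sym (length-iter m)) j<N))

at-iter-mono : ∀ {m m′ j} → m ≤′ m′ → j < N m → at (iter m′) j ≡ at (iter m) j
at-iter-mono (≤′-reflexive refl) _ = refl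
at-iter-mono (≤′-step {n = m′} m≤′m′) j<N =
  trans (at-iter-suc m′ (<-≤-trans j<N (N-mono-≤′ m≤′m′))) (at-iter-mono m≤′m′ j<N)

n'-stable : ∀ m j → j < N m → n' (suc j) ≡ at (iter m) j
n'-stable m j j<N with ≤-total m (suc j)
... | inj₁ m≤ = at-iter-mono (≤⇒≤′ m≤) j<N
... | inj₂ ≤m = sym (at-iter-mono (≤⇒≤′ ≤m) (<-trans (n<N j) (N-<-suc j)))

n'-shift : ∀ m r → 0 < r → r ≤ N m → n' (N (2 + m) + r) ≡ n' r
n'-shift m (suc r) _ r<N = begin
  n' (N (2 + m) + suc r)                      ≡⟨ cong n' (+-suc (N (2 + m)) r) ⟩
  n' (suc (N (2 + m) + r))                    ≡⟨ n'-stable (3 + m) _ (+-monoʳ-< (N (2 + m)) r<N) ⟩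
  at (iter (3 + m)) (N (2 + m) + r)           ≡⟨ cong (λ w → at w (N (2 + m) + r)) (iter-+3 m) ⟩
  at (iter (2 + m) ++ iter m) (N (2 + m) + r)
    ≡⟨ cong (λ x → at (iter (2 + m) ++ iter m) (x + r)) (length-iter (2 + m)) ⟨
  at (iter (2 + m) ++ iter m) (length (iter (2 + m)) + r) ≡⟨ at-++ʳ (iter (2 + m)) (iter m) r ⟩
  at (iter m) r                               ≡⟨ n'-stable m r r<N ⟨
  n' (suc r)                                  ∎
  where open ≡-Reasoning

n'-N : ∀ m → n' (N m) ≡ m % 3
n'-N 0 = refl
n'-N 1 = refl
n'-N 2 = refl
n'-N (suc (suc (suc m))) = begin
  n' (N (2 + m) + N m) ≡⟨ n'-shift m (N m) (N-pos m) ≤-refl ⟩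
  n' (N m)             ≡⟨ n'-N m ⟩
  m % 3                ≡⟨ [m+n]%n≡m%n m 3 ⟨
  (m + 3) % 3          ≡⟨ cong (_% 3) (+-comm m 3) ⟩
  (3 + m) % 3          ∎
  where open ≡-Reasoning

0^_ : ℕ → Word
0^ a = replicate a 0

Admissible : Word → Set
Admissible w = Binary w × NoBadFactor w

0^-++-∷ : ∀ a w → 0^ a ++ 0 ∷ w ≡ 0 ∷ 0^ a ++ w
0^-++-∷ zero w = refl
0^-++-∷ (suc a) w = cong (0 ∷_) (0^-++-∷ a w)

binary-0^-++⁺ : ∀ a {w} → Binary w → Binary (0^ a ++ w)
binary-0^-++⁺ zero b = b
binary-0^-++⁺ (suc a) b = inj₁ refl , binary-0^-++⁺ a b

binary-0^-++⁻ : ∀ a {w} → Binary (0^ a ++ w) → Binary w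
binary-0^-++⁻ zero b = b
binary-0^-++⁻ (suc a) (_ , b) = binary-0^-++⁻ a b

noBadFactor-0∷⁺ : ∀ w → NoBadFactor w → NoBadFactor (0 ∷ w)
noBadFactor-0∷⁺ [] _ = tt
noBadFactor-0∷⁺ (_ ∷ _) nb = nb

noBadFactor-0∷⁻ : ∀ w → NoBadFactor (0 ∷ w) → NoBadFactor w
noBadFactor-0∷⁻ [] _ = tt
noBadFactor-0∷⁻ (_ ∷ _) nb = nb

noBadFactor-0^-++⁺ : ∀ a w → NoBadFactor w → NoBadFactor (0^ a ++ w)
noBadFactor-0^-++⁺ zero w nb = nb
noBadFactor-0^-++⁺ (suc a) w nb = noBadFactor-0∷⁺ (0^ a ++ w) (noBadFactor-0^-++⁺ a w nb)

noBadFactor-0^-++⁻ : ∀ a w → NoBadFactor (0^ a ++ w) → NoBadFactor w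
noBadFactor-0^-++⁻ zero w nb = nb
noBadFactor-0^-++⁻ (suc a) w nb = noBadFactor-0^-++⁻ a w (noBadFactor-0∷⁻ (0^ a ++ w) nb)

admissible-1∷0^[2+d]-++ : ∀ d w → Admissible (1 ∷ 0^ (2 + d) ++ w) ⇔ Admissible w
admissible-1∷0^[2+d]-++ d w = mk⇔
  (λ { ((_ , b) , nb) → binary-0^-++⁻ (2 + d) b , noBadFactor-0^-++⁻ (1 + d) w nb })
  (λ { (b , nb) → (inj₂ refl , binary-0^-++⁺ (2 + d) b) , noBadFactor-0^-++⁺ (1 + d) w nb })

admissible-1∷0^ : ∀ a → Admissible (1 ∷ 0^ a)
admissible-1∷0^ 0 = (inj₂ refl , tt) , tt
admissible-1∷0^ 1 = (inj₂ refl , inj₁ refl , tt) , tt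
admissible-1∷0^ (suc (suc d)) = subst (λ w → Admissible (1 ∷ w)) (++-identityʳ (0^ (2 + d)))
  (from (admissible-1∷0^[2+d]-++ d []) (tt , tt))

zeros-or-last-one : ∀ v → Binary v → (∃ λ z → v ≡ 0^ z) ⊎ (∃₂ λ u z → v ≡ u ++ 1 ∷ 0^ z)
zeros-or-last-one [] _ = inj₁ (0 , refl)
zeros-or-last-one (.0 ∷ v) (inj₁ refl , b) with zeros-or-last-one v b
... | inj₁ (z , refl) = inj₁ (suc z , refl)
... | inj₂ (u , z , refl) = inj₂ (0 ∷ u , z , refl)
zeros-or-last-one (.1 ∷ v) (inj₂ refl , b) with zeros-or-last-one v b
... | inj₁ (z , refl) = inj₂ ([] , z , refl)
... | inj₂ (u , z , refl) = inj₂ (1 ∷ u , z , refl)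

last-one : ∀ v → Binary v → ∃₂ λ u z → 1 ∷ v ≡ u ++ 1 ∷ 0^ z
last-one v b with zeros-or-last-one v b
... | inj₁ (z , refl) = [] , z , refl
... | inj₂ (u , z , refl) = 1 ∷ u , z , refl

value-0^-++ : ∀ a w → value (0^ a ++ w) ≡ value w
value-0^-++ zero w = refl
value-0^-++ (suc a) w = value-0^-++ a w

value-1∷0^-++ : ∀ a w → value (1 ∷ 0^ a ++ w) ≡ N (a + length w) + value w
value-1∷0^-++ a w = begin
  N (length (0^ a ++ w)) + 0 + value (0^ a ++ w)
    ≡⟨ cong (_+ value (0^ a ++ w)) (+-identityʳ _) ⟩
  N (length (0^ a ++ w)) + value (0^ a ++ w)
    ≡⟨ cong (λ n → N n + value (0^ a ++ w)) (length-++ (0^ a)) ⟩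
  N (length (0^ a) + length w) + value (0^ a ++ w)
    ≡⟨ cong (λ n → N (n + length w) + value (0^ a ++ w)) (length-replicate a) ⟩
  N (a + length w) + value (0^ a ++ w)
    ≡⟨ cong (N (a + length w) +_) (value-0^-++ a w) ⟩
  N (a + length w) + value w ∎
  where open ≡-Reasoning

value-1∷0^ : ∀ a → value (1 ∷ 0^ a) ≡ N a
value-1∷0^ a = trans (cong (λ x → value (1 ∷ x)) (sym (++-identityʳ (0^ a))))
  (trans (value-1∷0^-++ a []) (trans (+-identityʳ _) (cong N (+-identityʳ a))))

N-length≤value-1∷ : ∀ v → N (length v) ≤ value (1 ∷ v)
N-length≤value-1∷ v = ≤-trans (m≤m+n (N (length v)) 0) (m≤m+n _ (value v))

0<value-1∷ : ∀ v → 0 < value (1 ∷ v)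
0<value-1∷ v = <-≤-trans (N-pos (length v)) (N-length≤value-1∷ v)

value-<-N : ∀ w → Admissible w → value w < N (length w)
value-<-N [] _ = s≤s z≤n
value-<-N (.0 ∷ w) ((inj₁ refl , b) , nb) =
  <-trans (value-<-N w (b , noBadFactor-0∷⁻ w nb)) (N-<-suc (length w))
value-<-N (.1 ∷ []) ((inj₂ refl , _) , _) = s≤s (s≤s z≤n)
value-<-N (.1 ∷ .0 ∷ []) ((inj₂ refl , inj₁ refl , _) , _) = s≤s (s≤s (s≤s z≤n))
value-<-N (.1 ∷ .1 ∷ w) ((inj₂ refl , inj₂ refl , b) , ())
value-<-N (.1 ∷ .0 ∷ .1 ∷ w) ((inj₂ refl , inj₁ refl , inj₂ refl , b) , ())
value-<-N (.1 ∷ .0 ∷ .0 ∷ w) ((inj₂ refl , inj₁ refl , inj₁ refl , b) , nb) =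
  subst (λ x → x + value w < N (2 + length w) + N (length w)) (sym (+-identityʳ _))
    (+-monoʳ-< (N (2 + length w)) (value-<-N w (b , noBadFactor-0∷⁻ w nb)))

n'-value-1∷0^[2+d]-++-1∷ : ∀ d v → Admissible (1 ∷ v) →
  n' (value (1 ∷ 0^ (2 + d) ++ 1 ∷ v)) ≡ n' (value (1 ∷ v))
n'-value-1∷0^[2+d]-++-1∷ d v adm =
  trans (cong n' (value-1∷0^-++ (2 + d) (1 ∷ v)))
    (n'-shift (d + length (1 ∷ v)) (value (1 ∷ v)) (0<value-1∷ v)
      (<⇒≤ (<-≤-trans (value-<-N (1 ∷ v) adm) (N-mono-≤ (m≤n+m _ d)))))

n'-value-1∷0^ : ∀ z → n' (value (1 ∷ 0^ z)) ≡ z % 3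
n'-value-1∷0^ z = trans (cong n' (value-1∷0^ z)) (n'-N z)

-- The accumulated zeros 0^a sit between the leading 1 and the part u still to be stripped.
n'-value-trailing : ∀ u a z → Admissible (1 ∷ 0^ a ++ u ++ 1 ∷ 0^ z) →
  n' (value (1 ∷ 0^ a ++ u ++ 1 ∷ 0^ z)) ≡ z % 3
n'-value-trailing [] 0 z (_ , ())
n'-value-trailing [] 1 z (_ , ())
n'-value-trailing [] (suc (suc d)) z adm =
  trans (n'-value-1∷0^[2+d]-++-1∷ d (0^ z) (to (admissible-1∷0^[2+d]-++ d _) adm))
        (n'-value-1∷0^ z)
n'-value-trailing (0 ∷ u) a z rewrite 0^-++-∷ a (u ++ 1 ∷ 0^ z) = n'-value-trailing u (suc a) z
n'-value-trailing (1 ∷ u) 0 z (_ , ())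
n'-value-trailing (1 ∷ u) 1 z (_ , ())
n'-value-trailing (1 ∷ u) (suc (suc d)) z adm =
  trans (n'-value-1∷0^[2+d]-++-1∷ d (u ++ 1 ∷ 0^ z) adm′) (n'-value-trailing u 0 z adm′)
  where adm′ = to (admissible-1∷0^[2+d]-++ d _) adm
n'-value-trailing (suc (suc x) ∷ u) a z ((_ , b) , _) with binary-0^-++⁻ a b
... | inj₁ () , _
... | inj₂ () , _

n'-trailing-zeros : ∀ u z k → IsNarayanaRep (u ++ 1 ∷ 0^ z) k → n' k ≡ z % 3
n'-trailing-zeros [] z _ (refl , _ , _ , refl) = n'-value-1∷0^ z
n'-trailing-zeros (_ ∷ u) z _ (refl , b , nb , refl) = n'-value-trailing u 0 z (b , nb)

N-bracket : ∀ k → 0 < k → ∃ λ t → N t ≤ k × k < N (suc t)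
N-bracket (suc zero) _ = 0 , s≤s z≤n , s≤s (s≤s z≤n)
N-bracket (suc (suc k)) _ with N-bracket (suc k) (s≤s z≤n)
... | t , Nt≤ , <Nt+1 with suc (suc k) <? N (suc t)
...   | yes <Nt+1′ = t , m≤n⇒m≤1+n Nt≤ , <Nt+1′
...   | no ≮Nt+1 = suc t , ≮⇒≥ ≮Nt+1 , ≤-<-trans <Nt+1 (N-<-suc (suc t))

Representation : ℕ → Set
Representation k = ∃ λ v → Admissible (1 ∷ v) × value (1 ∷ v) ≡ k

-- Below N_3 consecutive Narayana numbers differ by 1, leaving no room for a remainder.
representation-N+ : ∀ t v r → Admissible (1 ∷ v) → value (1 ∷ v) ≡ r →
  N t + r < N (suc t) → Representation (N t + r)
representation-N+ 0 v _ _ refl lt = ⊥-elim (<⇒≱ (+-cancelˡ-< (N 0) _ 1 lt) (0<value-1∷ v))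
representation-N+ 1 v _ _ refl lt = ⊥-elim (<⇒≱ (+-cancelˡ-< (N 1) _ 1 lt) (0<value-1∷ v))
representation-N+ 2 v _ _ refl lt = ⊥-elim (<⇒≱ (+-cancelˡ-< (N 2) _ 1 lt) (0<value-1∷ v))
representation-N+ (suc (suc (suc m))) v _ adm refl lt
  with m≤n⇒∃[o]m+o≡n {length v} {m} (≤-pred (N-cancel-< (≤-<-trans (N-length≤value-1∷ v)
         (+-cancelˡ-< (N (3 + m)) _ (N (1 + m)) lt))))
... | d , refl =
  0^ (2 + d) ++ 1 ∷ v ,
  from (admissible-1∷0^[2+d]-++ d (1 ∷ v)) adm ,
  trans (value-1∷0^-++ (2 + d) (1 ∷ v))
        (cong (λ n → N (suc (suc n)) + value (1 ∷ v)) (trans (+-suc d _) (cong suc (+-comm d _))))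

representation : ∀ k → 0 < k → Representation k
representation = <-rec (λ k → 0 < k → Representation k) greedy
  where
  greedy : ∀ k → (∀ {r} → r < k → 0 < r → Representation r) → 0 < k → Representation k
  greedy k rec 0<k with N-bracket k 0<k
  ... | t , Nt≤k , k<Nt+1 with m≤n⇒∃[o]m+o≡n Nt≤k
  ... | zero , refl = 0^ t , admissible-1∷0^ t , trans (value-1∷0^ t) (sym (+-identityʳ (N t)))
  ... | suc r , refl with rec (m<n+m (suc r) (N-pos t)) (s≤s z≤n)
  ...   | v , adm , val = representation-N+ t v (suc r) adm val k<Nt+1

[3*s+i]%3≡i : ∀ s {i} → i < 3 → (3 * s + i) % 3 ≡ i
[3*s+i]%3≡i s {i} i<3 = begin
  (3 * s + i) % 3 ≡⟨ cong (_% 3) (trans (+-comm (3 * s) i) (cong (i +_) (*-comm 3 s))) ⟩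
  (i + s * 3) % 3 ≡⟨ [m+kn]%n≡m%n i s 3 ⟩
  i % 3           ≡⟨ m<n⇒m%n≡m i<3 ⟩
  i               ∎
  where open ≡-Reasoning

m≡3*[m/3]+m%3 : ∀ m → m ≡ 3 * (m / 3) + m % 3
m≡3*[m/3]+m%3 m = trans (m≡m%n+[m/n]*n m 3) (trans (+-comm (m % 3) _) (cong (_+ m % 3) (*-comm (m / 3) 3)))

theorem23 : (i : ℕ) → i ≤ 2 → (k : ℕ) → 1 ≤ k →
    (n' k ≡ i) ⇔ ∃ λ s → ∃ λ u → IsNarayanaRep (u ++ 1 ∷ replicate (3 * s + i) 0) k
theorem23 i i≤2 k 0<k = mk⇔ trailing-zeros n'-from-trailing-zeros
  where
  trailing-zeros : n' k ≡ i → ∃ λ s → ∃ λ u → IsNarayanaRep (u ++ 1 ∷ 0^ (3 * s + i)) k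
  trailing-zeros n'k≡i with representation k 0<k
  ... | v , (b , nb) , val with last-one v (proj₂ b)
  ... | u , z , eq = z / 3 , u , subst (λ x → IsNarayanaRep (u ++ 1 ∷ 0^ x) k) z≡3[z/3]+i rep
    where
    rep : IsNarayanaRep (u ++ 1 ∷ 0^ z) k
    rep = subst (λ w → IsNarayanaRep w k) eq (refl , b , nb , val)
    z≡3[z/3]+i : z ≡ 3 * (z / 3) + i
    z≡3[z/3]+i = trans (m≡3*[m/3]+m%3 z)
      (cong (3 * (z / 3) +_) (trans (sym (n'-trailing-zeros u z k rep)) n'k≡i))
  n'-from-trailing-zeros : (∃ λ s → ∃ λ u → IsNarayanaRep (u ++ 1 ∷ 0^ (3 * s + i)) k) → n' k ≡ i
  n'-from-trailing-zeros (s , u , rep) =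
    trans (n'-trailing-zeros u (3 * s + i) k rep) ([3*s+i]%3≡i s (s≤s i≤2))
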